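{- Let $d\ge 2$ be an integer. Let $v,w,z$ be vertices of a graph $G$ that are pairwise twins. Then $\mathrm{rb}_d(G)=\mathrm{rb}_d(G-v)$.
   Context: Two vertices $v,w$ of $G$ are twins if $N_G(v)\setminus\{v,w\}=N_G(w)\setminus\{v,w\}$. For $S\subseteq V(G)$, the cut-rank $\rho_G(S)$ is the rank over the binary field of the $S\times (V(G)\setminus S)$ adjacency submatrix. The $\rho_G$-width of a partition $(X_1,\dots,X_m)$ of $V(G)$ is $\max\{\rho_G(\bigcup_{i\in I}X_i): I\subseteq\{1,\dots,m\}\}$. A decomposition of $G$ is a pair $(T,\sigma)$ of a tree $T$ with at least one internal node and a bijection $\sigma$ from $V(G)$ to the leaves of $T$; its radius is the radius of $T$. For an internal node $t$, the components of $T-t$ give (via $\sigma$) a partition of $V(G)$; the width of $t$ is the $\rho_G$-width of this partition; the width of $(T,\sigma)$ is the maximum width of an internal node. The depth-$d$ rank-brittleness $\mathrm{rb}_d(G)$ is the minimum $k$ such that $G$ admits a decomposition of width at most $k$ and radius at most $d$, and $\mathrm{rb}_d(G)=0$ if $|V(G)|<2$. -}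

module Defs where

open import Data.Nat using (ℕ; zero; suc; _≤_; _<_)
open import Data.Fin using (Fin; zero; suc; inject₁; fromℕ; punchIn)
open import Data.Bool using (Bool; true; false; _xor_; _∧_)
open import Data.Product using (Σ; ∃; _×_; _,_)
open import Data.Sum using (_⊎_)
open import Relation.Nullary using (¬_)
open import Relation.Binary.PropositionalEquality using (_≡_; _≢_)

record Graph (n : ℕ) : Set where
  field
    adj   : Fin n → Fin n → Bool
    sym   : ∀ x y → adj x y ≡ adj y x
    irref : ∀ x → adj x x ≡ false
open Graph public

_─_ : ∀ {n} → Graph (suc n) → Fin (suc n) → Graph n
adj   (G ─ v) i j = adj G (punchIn v i) (punchIn v j)
sym   (G ─ v) i j = sym G (punchIn v i) (punchIn v j)
irref (G ─ v) i   = irref G (punchIn v i)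

Twins : ∀ {n} → Graph n → Fin n → Fin n → Set
Twins G v w = ∀ u → u ≢ v → u ≢ w → adj G v u ≡ adj G w u

xsum : (r : ℕ) → (Fin r → Bool) → Bool
xsum zero    f = false
xsum (suc r) f = f zero xor xsum r (λ i → f (suc i))

-- A family of r rows (vertices of S) of the S × (V∖S) adjacency matrix
-- which is linearly independent over GF(2): every nonempty selection of
-- the rows has a nonzero sum (some column y ∉ S with entry 1).
IndepRows : ∀ {n} → Graph n → (Fin n → Bool) → (r : ℕ) → (Fin r → Fin n) → Set
IndepRows {n} G S r f =
  (∀ i → S (f i) ≡ true) ×
  (∀ (c : Fin r → Bool) → (∃ λ i → c i ≡ true) →
     ∃ λ (y : Fin n) → (S y ≡ false) × (xsum r (λ i → c i ∧ adj G (f i) y) ≡ true))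

-- ρ_G(S) ≤ k  (rank = maximum number of linearly independent rows)
CutRankLe : ∀ {n} → Graph n → (Fin n → Bool) → ℕ → Set
CutRankLe G S k = ∀ r f → IndepRows G S r f → r ≤ k

data Walk {m : ℕ} (T : Graph m) : Fin m → Fin m → ℕ → Set where
  here : ∀ a → Walk T a a 0
  step : ∀ {a b c ℓ} → adj T a b ≡ true → Walk T b c ℓ → Walk T a c (suc ℓ)

data WalkAvoid {m : ℕ} (T : Graph m) (t : Fin m) : Fin m → Fin m → ℕ → Set where
  here : ∀ a → a ≢ t → WalkAvoid T t a a 0
  step : ∀ {a b c ℓ} → a ≢ t → adj T a b ≡ true → WalkAvoid T t b c ℓ →
         WalkAvoid T t a c (suc ℓ)

Connected : ∀ {m} → Graph m → Set
Connected T = ∀ a b → ∃ λ ℓ → Walk T a b ℓ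

-- a cycle of length L+3 : distinct vertices, consecutive ones adjacent
IsCycle : ∀ {m} → Graph m → (L : ℕ) → (Fin (suc (suc (suc L))) → Fin m) → Set
IsCycle T L f =
  (∀ i j → f i ≡ f j → i ≡ j) ×
  (∀ (i : Fin (suc (suc L))) → adj T (f (inject₁ i)) (f (suc i)) ≡ true) ×
  (adj T (f (fromℕ (suc (suc L)))) (f zero) ≡ true)

Acyclic : ∀ {m} → Graph m → Set
Acyclic T = ∀ L f → ¬ IsCycle T L f

IsTree : ∀ {m} → Graph m → Set
IsTree T = Connected T × Acyclic T

IsLeaf : ∀ {m} → Graph m → Fin m → Set
IsLeaf T t = ∀ a b → adj T t a ≡ true → adj T t b ≡ true → a ≡ b

Internal : ∀ {m} → Graph m → Fin m → Set
Internal T t = ¬ IsLeaf T t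

RadiusLe : ∀ {m} → Graph m → ℕ → Set
RadiusLe T d = ∃ λ c → ∀ t → ∃ λ ℓ → ℓ ≤ d × Walk T c t ℓ

record Decomposition {n : ℕ} (G : Graph n) : Set where
  field
    m        : ℕ
    T        : Graph m
    isTree   : IsTree T
    internal : ∃ λ t → Internal T t
    σ        : Fin n → Fin m
    σ-inj    : ∀ x y → σ x ≡ σ y → x ≡ y
    σ-leaf   : ∀ x → IsLeaf T (σ x)
    σ-onto   : ∀ t → IsLeaf T t → ∃ λ x → σ x ≡ t
open Decomposition public

SameComp : ∀ {n} {G : Graph n} (D : Decomposition G) → Fin (m D) → Fin n → Fin n → Set
SameComp D t x y = ∃ λ ℓ → WalkAvoid (T D) t (σ D x) (σ D y) ℓ

-- width of internal node t ≤ k : every union S of parts of the partition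
-- induced by the components of T - t has ρ_G(S) ≤ k.  (S ⊆ V(G) is a union
-- of parts iff it is closed under SameComp.)
NodeWidthLe : ∀ {n} {G : Graph n} (D : Decomposition G) → Fin (m D) → ℕ → Set
NodeWidthLe {n} {G} D t k =
  ∀ (S : Fin n → Bool) → (∀ x y → SameComp D t x y → S x ≡ S y) → CutRankLe G S k

WidthLe : ∀ {n} {G : Graph n} → Decomposition G → ℕ → Set
WidthLe D k = ∀ t → Internal (T D) t → NodeWidthLe D t k

HasDecomp : ∀ {n} → Graph n → ℕ → ℕ → Set
HasDecomp G d k = Σ (Decomposition G) λ D → WidthLe D k × RadiusLe (T D) d

Rb : ∀ {n} → ℕ → Graph n → ℕ → Set
Rb {n} d G k =
  (n < 2 × k ≡ 0) ⊎
  (2 ≤ n × HasDecomp G d k × (∀ k' → HasDecomp G d k' → k ≤ k'))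

-- Both graphs have at least two vertices, so it suffices to turn a decomposition
-- of either graph into one of the other with the same width and radius bounds.
-- G − v → G: attach a new leaf for v to the neighbour p of the leaf of w.  At a
-- node t ≠ p, v lies in the part of w, and deleting a vertex whose twin is on its
-- side of a cut does not lower the cut-rank.  At p, if S(v) differs from S(w) and
-- S(z) then S(w) = S(z); swapping the twins v, w (an automorphism) makes v agree
-- with z, while the leaf of w is a part on its own.  The radius bound uses d ≥ 2.
-- G → G − v: forget the label of v (a cut of G − v has rank at most that of any
-- extension to G), then prune unlabelled leaves one at a time.
-- Every cut-rank comparison is an instance of one transfer principle: a vertex map
-- respecting the sides of the cuts and the adjacency across them preserves
-- independence of rows.

module Submission where

open import Defs
open import Data.Nat using (ℕ; zero; suc; _≤_; _≤?_; _+_; z≤n; s≤s)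
open import Data.Nat.Properties using (≤-trans; m≤n⇒m≤1+n; n≤1+n; <⇒≱)
open import Data.Fin using (Fin; zero; suc; punchIn; punchOut; inject₁; fromℕ; toℕ; _≟_)
open import Data.Fin.Properties
  using ( punchIn-punchOut; punchInᵢ≢i; punchIn-injective; punchOut-injective
        ; suc-injective; toℕ-inject₁; any?; all?)
open import Data.Fin.Permutation.Components using (transpose; transpose-inverse)
open import Data.Bool using (Bool; true; false; _xor_; _∧_)
open import Data.Bool.Properties using (¬-not) renaming (_≟_ to _≟ᵇ_)
open import Data.Product using (∃; _×_; _,_; proj₁; proj₂)
open import Data.Sum using (_⊎_; inj₁; inj₂)
open import Data.Empty using (⊥-elim)
open import Relation.Nullary using (¬_; Dec; yes; no; does)
open import Relation.Nullary.Decidable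
  using (decidable-stable; ¬¬-excluded-middle; dec-true; dec-false; _×-dec_; _→-dec_; ¬?)
open import Relation.Binary.PropositionalEquality
  using (_≡_; _≢_; refl; cong; cong₂; trans; subst; subst₂; module ≡-Reasoning)
  renaming (sym to ≡-sym)
open import Function using (_∘_)
open import Data.Vec.Functional using (insertAt)
open import Data.Vec.Functional.Properties using (insertAt-lookup; insertAt-punchIn)

module _ {m : ℕ} {T : Graph m} where

  snocʷ : ∀ {a b c ℓ} → Walk T a b ℓ → adj T b c ≡ true → Walk T a c (suc ℓ)
  snocʷ (here _)   e′ = step e′ (here _)
  snocʷ (step e w) e′ = step e (snocʷ w e′)

  unsnocʷ : ∀ {a c ℓ} → Walk T a c (suc ℓ) → ∃ λ b → Walk T a b ℓ × adj T b c ≡ true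
  unsnocʷ (step e (here _))    = _ , here _ , e
  unsnocʷ (step e (step e′ w)) with unsnocʷ (step e′ w)
  ... | b , w′ , e″ = b , step e w′ , e″

  startᵃ : ∀ {t a b ℓ} → WalkAvoid T t a b ℓ → a ≢ t
  startᵃ (here _ a≢t)   = a≢t
  startᵃ (step a≢t _ _) = a≢t

  snocᵃ : ∀ {t a b c ℓ} → WalkAvoid T t a b ℓ → adj T b c ≡ true → c ≢ t →
          WalkAvoid T t a c (suc ℓ)
  snocᵃ (here _ a≢t)   e′ c≢t = step a≢t e′ (here _ c≢t)
  snocᵃ (step a≢t e w) e′ c≢t = step a≢t e (snocᵃ w e′ c≢t)

  reverseᵃ : ∀ {t a b ℓ} → WalkAvoid T t a b ℓ → WalkAvoid T t b a ℓ
  reverseᵃ (here a a≢t)           = here a a≢t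
  reverseᵃ (step {a} {b} a≢t e w) = snocᵃ (reverseᵃ w) (trans (sym T b a) e) a≢t

  _++ᵃ_ : ∀ {t a b c ℓ ℓ′} → WalkAvoid T t a b ℓ → WalkAvoid T t b c ℓ′ →
          WalkAvoid T t a c (ℓ + ℓ′)
  here _ _   ++ᵃ w′ = w′
  step x e w ++ᵃ w′ = step x e (w ++ᵃ w′)

module _ {m m′} {T : Graph m} {T′ : Graph m′} (h : Fin m → Fin m′)
         (h-adj : ∀ a b → adj T a b ≡ adj T′ (h a) (h b)) where

  mapʷ : ∀ {a b ℓ} → Walk T a b ℓ → Walk T′ (h a) (h b) ℓ
  mapʷ (here a)           = here (h a)
  mapʷ (step {a} {b} e w) = step (trans (≡-sym (h-adj a b)) e) (mapʷ w)

  mapᵃ : ∀ {t} → (∀ a → a ≢ t → h a ≢ h t) →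
         ∀ {a b ℓ} → WalkAvoid T t a b ℓ → WalkAvoid T′ (h t) (h a) (h b) ℓ
  mapᵃ h-sep (here a a≢t)           = here (h a) (h-sep a a≢t)
  mapᵃ h-sep (step {a} {b} a≢t e w) =
    step (h-sep a a≢t) (trans (≡-sym (h-adj a b)) e) (mapᵃ h-sep w)

module _ {m : ℕ} {T : Graph m} where

  trappedAtLeafPair : ∀ {a b} → adj T a b ≡ true → IsLeaf T a → IsLeaf T b →
                      ∀ {x y ℓ} → Walk T x y ℓ → (x ≡ a ⊎ x ≡ b) → (y ≡ a ⊎ y ≡ b)
  trappedAtLeafPair e la lb (here _) x∈ab = x∈ab
  trappedAtLeafPair {a} {b} e la lb (step {b = y} e′ w) (inj₁ refl) =
    trappedAtLeafPair e la lb w (inj₂ (la y b e′ e))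
  trappedAtLeafPair {a} {b} e la lb (step {b = y} e′ w) (inj₂ refl) =
    trappedAtLeafPair e la lb w (inj₁ (lb y a e′ (trans (sym T b a) e)))

  leaves-nonadjacent : Connected T → (∃ λ t → Internal T t) →
                       ∀ {a b} → IsLeaf T a → IsLeaf T b → adj T a b ≢ true
  leaves-nonadjacent conn (t , int) {a} la lb e
    with trappedAtLeafPair e la lb (proj₂ (conn a t)) (inj₁ refl)
  ... | inj₁ refl = int la
  ... | inj₂ refl = int lb

  internalOnWalk : ∀ {a b ℓ} → Walk T a b ℓ → a ≢ b → adj T a b ≡ false →
                   ∃ λ u → Internal T u
  internalOnWalk (here a)          a≢b _    = ⊥-elim (a≢b refl)
  internalOnWalk (step e (here _)) _   nadj with trans (≡-sym e) nadj
  ... | ()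
  internalOnWalk {a} (step {b = x₁} e (step {b = x₂} e′ w)) a≢b nadj with x₂ ≟ a
  ... | yes refl = internalOnWalk w a≢b nadj
  ... | no x₂≢a  = x₁ , λ leaf → x₂≢a (leaf x₂ a e′ (trans (sym T x₁ a) e))

  pendantAlone : ∀ {p a b ℓ} → WalkAvoid T p a b ℓ → IsLeaf T a → adj T a p ≡ true →
                 a ≡ b
  pendantAlone (here _ _)    _    _ = refl
  pendantAlone (step _ e′ w) leaf e = ⊥-elim (startᵃ w (leaf _ _ e′ e))

lastOrInject : ∀ {K} (j : Fin (suc K)) → j ≡ fromℕ K ⊎ ∃ λ j′ → inject₁ j′ ≡ j
lastOrInject {zero}  zero    = inj₁ refl
lastOrInject {suc K} zero    = inj₂ (zero , refl)
lastOrInject {suc K} (suc j) with lastOrInject j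
... | inj₁ eq        = inj₁ (cong suc eq)
... | inj₂ (j′ , eq) = inj₂ (suc j′ , cong suc eq)

inject₁²≢suc² : ∀ {K} (j : Fin K) → inject₁ (inject₁ j) ≢ suc (suc j)
inject₁²≢suc² j eq = x≢2+x
  (trans (≡-sym (trans (toℕ-inject₁ (inject₁ j)) (toℕ-inject₁ j))) (cong toℕ eq))
  where
  x≢2+x : ∀ {x} → x ≢ suc (suc x)
  x≢2+x ()

cycleNeighbours : ∀ {m} {T : Graph m} {L f} → IsCycle T L f → ∀ i →
                  ∃ λ j₁ → ∃ λ j₂ → j₁ ≢ j₂ ×
                    adj T (f i) (f j₁) ≡ true × adj T (f i) (f j₂) ≡ true
cycleNeighbours {T = T} {L} (_ , edge , closing) zero =
  fromℕ (suc (suc L)) , suc zero , (λ ()) , trans (sym T _ _) closing , edge zero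
cycleNeighbours {T = T} {L} (_ , edge , closing) (suc j) with lastOrInject j
... | inj₁ refl       = inject₁ (fromℕ (suc L)) , zero , (λ ()) ,
                        trans (sym T _ _) (edge (fromℕ (suc L))) , closing
... | inj₂ (j′ , refl) = inject₁ (inject₁ j′) , suc (suc j′) , inject₁²≢suc² j′ ,
                        trans (sym T _ _) (edge (inject₁ j′)) , edge (suc j′)

leafOffCycle : ∀ {m} {T : Graph m} {L f} → IsCycle T L f → ∀ i → ¬ IsLeaf T (f i)
leafOffCycle {T = T} cyc i leaf with cycleNeighbours {T = T} cyc i
... | j₁ , j₂ , j₁≢j₂ , e₁ , e₂ = j₁≢j₂ (proj₁ cyc j₁ j₂ (leaf _ _ e₁ e₂))

xsum-cong : ∀ r {f g : Fin r → Bool} → (∀ i → f i ≡ g i) → xsum r f ≡ xsum r g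
xsum-cong zero    eq = refl
xsum-cong (suc r) eq = cong₂ _xor_ (eq zero) (xsum-cong r (eq ∘ suc))

cutRank-transfer : ∀ {n n′} (G : Graph n) (H : Graph n′)
  (S : Fin n → Bool) (S′ : Fin n′ → Bool) (h : Fin n → Fin n′) →
  (∀ x → S′ (h x) ≡ S x) →
  (∀ x y → S x ≡ true → S y ≡ false → adj H (h x) (h y) ≡ adj G x y) →
  ∀ {k} → CutRankLe H S′ k → CutRankLe G S k
cutRank-transfer G H S S′ h side across bound r f (rows , cols) =
  bound r (h ∘ f) (rows′ , cols′)
  where
  rows′ : ∀ i → S′ (h (f i)) ≡ true
  rows′ i = trans (side (f i)) (rows i)
  cols′ : ∀ c → (∃ λ i → c i ≡ true) →
          ∃ λ y → S′ y ≡ false × xsum r (λ i → c i ∧ adj H (h (f i)) y) ≡ true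
  cols′ c nonzero with cols c nonzero
  ... | y , Sy , sum = h y , trans (side y) Sy ,
        trans (xsum-cong r λ i → cong (c i ∧_) (across (f i) y (rows i) Sy)) sum

cutRank-restrict : ∀ {n} (G : Graph (suc n)) (v : Fin (suc n))
  (S′ : Fin (suc n) → Bool) (S : Fin n → Bool) → (∀ i → S′ (punchIn v i) ≡ S i) →
  ∀ {k} → CutRankLe G S′ k → CutRankLe (G ─ v) S k
cutRank-restrict G v S′ S extends =
  cutRank-transfer (G ─ v) G S S′ (punchIn v) extends (λ _ _ _ _ → refl)

-- Since "r ≤ k" is decidable, a cut-rank bound is stable under double negation.
cutRank-stable : ∀ {n} {G : Graph n} {S k} → ¬ ¬ CutRankLe G S k → CutRankLe G S k
cutRank-stable {k = k} ¬¬bound r f indep =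
  decidable-stable (r ≤? k) λ r≰k → ¬¬bound λ bound → r≰k (bound r f indep)

sides-differ : ∀ {a b : Bool} → a ≡ true → b ≡ false → a ≢ b
sides-differ refl refl ()

other-side : ∀ {a b c : Bool} → a ≢ b → a ≢ c → b ≡ c
other-side a≢b a≢c = trans (¬-not (a≢b ∘ ≡-sym)) (≡-sym (¬-not (a≢c ∘ ≡-sym)))

twins-sym : ∀ {n} {G : Graph n} {v w} → Twins G v w → Twins G w v
twins-sym tw u u≢w u≢v = ≡-sym (tw u u≢v u≢w)

twins-seen : ∀ {n} {G : Graph n} {v w} → Twins G v w →
             ∀ u → u ≢ v → u ≢ w → adj G u v ≡ adj G u w
twins-seen {G = G} {v} {w} tw u u≢v u≢w =
  trans (sym G u v) (trans (tw u u≢v u≢w) (sym G w u))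

data DeletionView {n} (v : Fin (suc n)) : Fin (suc n) → Set where
  deleted : DeletionView v v
  kept    : ∀ i → DeletionView v (punchIn v i)

deletionView : ∀ {n} (v x : Fin (suc n)) → DeletionView v x
deletionView v x with v ≟ x
... | yes refl = deleted
... | no v≢x   = subst (DeletionView v) (punchIn-punchOut v≢x) (kept (punchOut v≢x))

-- The
-- witnessing map sends v to u and fixes every other vertex.
module _ {n} (G : Graph (suc n)) {v u : Fin (suc n)} (v≢u : v ≢ u) (tw : Twins G v u) where

  private
    collapse : Fin (suc n) → Fin n
    collapse x with deletionView v x
    ... | deleted = punchOut v≢u
    ... | kept i  = i

  cutRank-twinDelete : ∀ (S : Fin (suc n) → Bool) → S v ≡ S u →
    ∀ {k} → CutRankLe (G ─ v) (S ∘ punchIn v) k → CutRankLe G S k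
  cutRank-twinDelete S Sv≡Su = cutRank-transfer G (G ─ v) S (S ∘ punchIn v) collapse side across
    where
    side : ∀ x → S (punchIn v (collapse x)) ≡ S x
    side x with deletionView v x
    ... | deleted = trans (cong S (punchIn-punchOut v≢u)) (≡-sym Sv≡Su)
    ... | kept i  = refl
    not-u : ∀ y → S y ≢ S v → y ≢ u
    not-u y Sy≢Sv refl = Sy≢Sv (≡-sym Sv≡Su)
    across : ∀ x y → S x ≡ true → S y ≡ false →
             adj G (punchIn v (collapse x)) (punchIn v (collapse y)) ≡ adj G x y
    across x y Sx Sy with deletionView v x | deletionView v y
    ... | deleted | deleted = ⊥-elim (sides-differ Sx Sy refl)
    ... | deleted | kept j  =
      trans (cong (λ a → adj G a (punchIn v j)) (punchIn-punchOut v≢u))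
            (≡-sym (tw (punchIn v j) (punchInᵢ≢i v j)
                       (not-u _ λ Sj≡Sv → sides-differ Sx Sy (≡-sym Sj≡Sv))))
    ... | kept i  | deleted =
      trans (cong (adj G (punchIn v i)) (punchIn-punchOut v≢u))
            (≡-sym (twins-seen {G = G} tw (punchIn v i) (punchInᵢ≢i v i)
                       (not-u _ (sides-differ Sx Sy))))
    ... | kept i  | kept j  = refl

data TransposeView {N} (v w x : Fin N) : Fin N → Set where
  at-v  : x ≡ v → TransposeView v w x w
  at-w  : x ≡ w → TransposeView v w x v
  fixed : x ≢ v → x ≢ w → TransposeView v w x x

transposeView : ∀ {N} (v w x : Fin N) → TransposeView v w x (transpose v w x)
transposeView v w x with x ≟ v
... | yes x≡v = at-v x≡v
... | no x≢v with x ≟ w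
...   | yes x≡w = at-w x≡w
...   | no x≢w  = fixed x≢v x≢w

transpose-first : ∀ {N} (v w : Fin N) → transpose v w v ≡ w
transpose-first v w with transpose v w v | transposeView v w v
... | _ | at-v _         = refl
... | _ | at-w refl     = refl
... | _ | fixed v≢v _   = ⊥-elim (v≢v refl)

transpose-fixes : ∀ {N} {v w x : Fin N} → x ≢ v → x ≢ w → transpose v w x ≡ x
transpose-fixes {v = v} {w} {x} x≢v x≢w with transpose v w x | transposeView v w x
... | _ | at-v x≡v   = ⊥-elim (x≢v x≡v)
... | _ | at-w x≡w   = ⊥-elim (x≢w x≡w)
... | _ | fixed _ _  = refl

transpose-automorphism : ∀ {N} (G : Graph N) {v w} → Twins G v w →
  ∀ x y → adj G (transpose v w x) (transpose v w y) ≡ adj G x y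
transpose-automorphism G {v} {w} tw x y
  with transpose v w x | transposeView v w x | transpose v w y | transposeView v w y
... | _ | at-v refl | _ | at-v refl = trans (irref G w) (≡-sym (irref G v))
... | _ | at-v refl | _ | at-w refl = sym G w v
... | _ | at-v refl | _ | fixed y≢v y≢w = ≡-sym (tw y y≢v y≢w)
... | _ | at-w refl | _ | at-v refl = sym G v w
... | _ | at-w refl | _ | at-w refl = trans (irref G v) (≡-sym (irref G w))
... | _ | at-w refl | _ | fixed y≢v y≢w = tw y y≢v y≢w
... | _ | fixed x≢v x≢w | _ | at-v refl = ≡-sym (twins-seen {G = G} tw x x≢v x≢w)
... | _ | fixed x≢v x≢w | _ | at-w refl = twins-seen {G = G} tw x x≢v x≢w
... | _ | fixed _ _ | _ | fixed _ _ = refl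

cutRank-twinSwap : ∀ {N} (G : Graph N) {v w} → Twins G v w → (S : Fin N → Bool) →
  ∀ {k} → CutRankLe G (S ∘ transpose v w) k → CutRankLe G S k
cutRank-twinSwap G {v} {w} tw S =
  cutRank-transfer G G S (S ∘ transpose v w) (transpose w v)
    (λ _ → cong S (transpose-inverse v w))
    (λ x y _ _ → transpose-automorphism G (twins-sym {G = G} tw) x y)

module Attach {m : ℕ} (T : Graph m) (p : Fin m) where

  private
    adj⁺ : Fin (suc m) → Fin (suc m) → Bool
    adj⁺ zero    zero    = false
    adj⁺ zero    (suc j) = does (j ≟ p)
    adj⁺ (suc i) zero    = does (i ≟ p)
    adj⁺ (suc i) (suc j) = adj T i j

    sym⁺ : ∀ x y → adj⁺ x y ≡ adj⁺ y x
    sym⁺ zero    zero    = refl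
    sym⁺ zero    (suc j) = refl
    sym⁺ (suc i) zero    = refl
    sym⁺ (suc i) (suc j) = sym T i j

    irref⁺ : ∀ x → adj⁺ x x ≡ false
    irref⁺ zero    = refl
    irref⁺ (suc i) = irref T i

    neighbour-is-p : ∀ {j} → does (j ≟ p) ≡ true → j ≡ p
    neighbour-is-p {j} e =
      decidable-stable (j ≟ p) λ j≢p → sides-differ e (dec-false (j ≟ p) j≢p) refl

  T⁺ : Graph (suc m)
  T⁺ = record { adj = adj⁺ ; sym = sym⁺ ; irref = irref⁺ }

  new-edge : adj T⁺ zero (suc p) ≡ true
  new-edge = dec-true (p ≟ p) refl

  new-edge′ : adj T⁺ (suc p) zero ≡ true
  new-edge′ = new-edge

  lift : ∀ {a b ℓ} → Walk T a b ℓ → Walk T⁺ (suc a) (suc b) ℓ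
  lift = mapʷ suc (λ _ _ → refl)

  liftᵃ : ∀ {t a b ℓ} → WalkAvoid T t a b ℓ → WalkAvoid T⁺ (suc t) (suc a) (suc b) ℓ
  liftᵃ = mapᵃ suc (λ _ _ → refl) (λ a a≢t eq → a≢t (suc-injective eq))

  new-leaf : IsLeaf T⁺ zero
  new-leaf (suc a) (suc b) e₁ e₂ = cong suc (trans (neighbour-is-p e₁) (≡-sym (neighbour-is-p e₂)))

  old-leaf : ∀ {s} → IsLeaf T s → s ≢ p → IsLeaf T⁺ (suc s)
  old-leaf leaf s≢p zero    _       e₁ _  = ⊥-elim (s≢p (neighbour-is-p e₁))
  old-leaf leaf s≢p (suc a) zero    _  e₂ = ⊥-elim (s≢p (neighbour-is-p e₂))
  old-leaf leaf s≢p (suc a) (suc b) e₁ e₂ = cong suc (leaf a b e₁ e₂)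

  leaf-before : ∀ {s} → IsLeaf T⁺ (suc s) → IsLeaf T s
  leaf-before leaf a b e₁ e₂ = suc-injective (leaf (suc a) (suc b) e₁ e₂)

  -- Attaching a leaf to a tree gives a tree: the new node is reached through p,
  -- and it cannot lie on a cycle, so every cycle of T⁺ is a cycle of T.
  connected⁺ : Connected T → Connected T⁺
  connected⁺ conn zero    zero    = 0 , here zero
  connected⁺ conn zero    (suc b) = let (ℓ , w) = conn p b in suc ℓ , step new-edge (lift w)
  connected⁺ conn (suc a) zero    = let (ℓ , w) = conn a p in suc ℓ , snocʷ (lift w) new-edge′
  connected⁺ conn (suc a) (suc b) = let (ℓ , w) = conn a b in ℓ , lift w

  acyclic⁺ : Acyclic T → Acyclic T⁺
  acyclic⁺ acyc L f cyc@(f-inj , edge , closing) with any? (λ i → f i ≟ zero)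
  ... | yes (i , fi≡0) = leafOffCycle {T = T⁺} cyc i (subst (IsLeaf T⁺) (≡-sym fi≡0) new-leaf)
  ... | no  avoids0    = acyc L g (g-inj , g-edge , g-closing)
    where
    old : ∀ i → ∃ λ a → suc a ≡ f i
    old i with f i in fi≡
    ... | zero  = ⊥-elim (avoids0 (i , fi≡))
    ... | suc a = a , refl
    g : Fin (suc (suc (suc L))) → Fin m
    g i = proj₁ (old i)
    g-adj : ∀ i j → adj T (g i) (g j) ≡ adj T⁺ (f i) (f j)
    g-adj i j = cong₂ (adj T⁺) (proj₂ (old i)) (proj₂ (old j))
    g-inj : ∀ i j → g i ≡ g j → i ≡ j
    g-inj i j eq = f-inj i j (trans (≡-sym (proj₂ (old i))) (trans (cong suc eq) (proj₂ (old j))))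
    g-edge : ∀ i → adj T (g (inject₁ i)) (g (suc i)) ≡ true
    g-edge i = trans (g-adj _ _) (edge i)
    g-closing : adj T (g (fromℕ (suc (suc L)))) (g zero) ≡ true
    g-closing = trans (g-adj _ _) closing

  isTree⁺ : IsTree T → IsTree T⁺
  isTree⁺ (conn , acyc) = connected⁺ conn , acyclic⁺ acyc

-- Deleting a leaf ℓ from T.  A walk between two other nodes that visits ℓ must
-- enter and leave ℓ through its unique neighbour, so the detour can be cut out.
module LeafDeletion {m : ℕ} (T : Graph (suc m)) (ℓ : Fin (suc m)) (leaf : IsLeaf T ℓ) where

  shortcutʷ : ∀ {x y L} → Walk T x y L → ∀ {a b} → x ≡ punchIn ℓ a → y ≡ punchIn ℓ b →
              ∃ λ L′ → L′ ≤ L × Walk (T ─ ℓ) a b L′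
  shortcutʷ (here _) {a} {b} refl y≡b =
    0 , z≤n , subst (λ c → Walk (T ─ ℓ) a c 0) (punchIn-injective ℓ a b y≡b) (here a)
  shortcutʷ (step {b = c} e w) refl y≡b with deletionView ℓ c
  ... | kept c′ = let (L′ , L′≤ , w′) = shortcutʷ w refl y≡b in suc L′ , s≤s L′≤ , step e w′
  ... | deleted with w
  ...   | here _ = ⊥-elim (punchInᵢ≢i ℓ _ (≡-sym y≡b))
  ...   | step e′ w′ =
    let (L′ , L′≤ , w″) = shortcutʷ w′ (leaf _ _ e′ (trans (sym T _ _) e)) y≡b
    in L′ , m≤n⇒m≤1+n (m≤n⇒m≤1+n L′≤) , w″

  shortcutᵃ : ∀ {t x y L} → WalkAvoid T (punchIn ℓ t) x y L →
              ∀ {a b} → x ≡ punchIn ℓ a → y ≡ punchIn ℓ b →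
              ∃ λ L′ → WalkAvoid (T ─ ℓ) t a b L′
  shortcutᵃ {t} (here _ x≢t) {a} {b} refl y≡b =
    0 , subst (λ c → WalkAvoid (T ─ ℓ) t a c 0) (punchIn-injective ℓ a b y≡b)
              (here a λ a≡t → x≢t (cong (punchIn ℓ) a≡t))
  shortcutᵃ (step {b = c} x≢t e w) refl y≡b with deletionView ℓ c
  ... | kept c′ = let (L′ , w′) = shortcutᵃ w refl y≡b
                  in suc L′ , step (λ a≡t → x≢t (cong (punchIn ℓ) a≡t)) e w′
  ... | deleted with w
  ...   | here _ _ = ⊥-elim (punchInᵢ≢i ℓ _ (≡-sym y≡b))
  ...   | step _ e′ w′ = shortcutᵃ w′ (leaf _ _ e′ (trans (sym T _ _) e)) y≡b

  isTree⁻ : IsTree T → IsTree (T ─ ℓ)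
  isTree⁻ (conn , acyc) = connected⁻ , acyclic⁻
    where
    connected⁻ : Connected (T ─ ℓ)
    connected⁻ a b =
      let (L′ , _ , w) = shortcutʷ (proj₂ (conn (punchIn ℓ a) (punchIn ℓ b))) refl refl
      in L′ , w
    acyclic⁻ : Acyclic (T ─ ℓ)
    acyclic⁻ L f (f-inj , edge , closing) =
      acyc L (punchIn ℓ ∘ f) ((λ i j eq → f-inj i j (punchIn-injective ℓ _ _ eq)) , edge , closing)

  leaf⁻ : ∀ {s} → IsLeaf T (punchIn ℓ s) → IsLeaf (T ─ ℓ) s
  leaf⁻ leaf′ a b e₁ e₂ = punchIn-injective ℓ a b (leaf′ _ _ e₁ e₂)

  neighbour : Connected T → Fin m → ∃ λ c → adj T ℓ (punchIn ℓ c) ≡ true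
  neighbour conn t₀ = first (proj₂ (conn ℓ (punchIn ℓ t₀))) refl
    where
    first : ∀ {y L} → Walk T ℓ y L → y ≡ punchIn ℓ t₀ → ∃ λ c → adj T ℓ (punchIn ℓ c) ≡ true
    first (here _) ℓ≡ = ⊥-elim (punchInᵢ≢i ℓ t₀ (≡-sym ℓ≡))
    first (step {b = b} e _) _ with deletionView ℓ b
    ... | deleted = ⊥-elim (sides-differ e (irref T ℓ) refl)
    ... | kept b′ = b′ , e

  fromNeighbour : ∀ {c} → adj T ℓ (punchIn ℓ c) ≡ true →
                  ∀ {y t L} → Walk T ℓ y L → y ≡ punchIn ℓ t →
                  ∃ λ L′ → L′ ≤ L × Walk (T ─ ℓ) c t L′
  fromNeighbour _  (here _)   ℓ≡ = ⊥-elim (punchInᵢ≢i ℓ _ (≡-sym ℓ≡))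
  fromNeighbour eℓ (step e w) y≡ =
    let (L′ , L′≤ , w′) = shortcutʷ w (leaf _ _ e eℓ) y≡ in L′ , m≤n⇒m≤1+n L′≤ , w′

  -- The radius does not grow; if ℓ was the centre, its neighbour becomes one.
  radius⁻ : ∀ {d} → Connected T → Fin m → RadiusLe T d → RadiusLe (T ─ ℓ) d
  radius⁻ {d} conn t₀ (c , ecc) with deletionView ℓ c
  ... | kept c′ = c′ , λ t → let (L , L≤d , w) = ecc (punchIn ℓ t)
                                 (L′ , L′≤L , w′) = shortcutʷ w refl refl
                             in L′ , ≤-trans L′≤L L≤d , w′
  ... | deleted = let (c′ , eℓ) = neighbour conn t₀ in
                  c′ , λ t → let (L , L≤d , w) = ecc (punchIn ℓ t)
                                 (L′ , L′≤L , w′) = fromNeighbour eℓ w refl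
                             in L′ , ≤-trans L′≤L L≤d , w′

-- A draft is a
-- decomposition in the making: the labelling is injective into the leaves,
-- but some leaves may still be unlabelled.
Together : ∀ {m n} → Graph m → (Fin n → Fin m) → Fin m → Fin n → Fin n → Set
Together T σ t x y = ∃ λ L → WalkAvoid T t (σ x) (σ y) L

LabelledWidthLe : ∀ {m n} → Graph n → Graph m → (Fin n → Fin m) → ℕ → Set
LabelledWidthLe G T σ k =
  ∀ t → Internal T t → ∀ S → (∀ x y → Together T σ t x y → S x ≡ S y) → CutRankLe G S k

record Draft {n} (G : Graph n) (d k m : ℕ) : Set where
  field
    tree       : Graph m
    tree-ok    : IsTree tree
    label      : Fin n → Fin m
    label-inj  : ∀ x y → label x ≡ label y → x ≡ y
    label-leaf : ∀ x → IsLeaf tree (label x)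
    width      : LabelledWidthLe G tree label k
    radius     : RadiusLe tree d

deleteLeaf : ∀ {n m d k} {G : Graph n} (D : Draft G d k (suc m)) → let open Draft D in
  (ℓ : Fin (suc m)) → IsLeaf tree ℓ → (∀ x → ℓ ≢ label x) → Fin n → Draft G d k m
deleteLeaf {n} {m} D ℓ leaf unlabelled x₀ = record
  { tree       = tree ─ ℓ
  ; tree-ok    = isTree⁻ tree-ok
  ; label      = label⁻
  ; label-inj  = λ x y eq → label-inj x y (trans (≡-sym (label⁻-spec x))
                                           (trans (cong (punchIn ℓ) eq) (label⁻-spec y)))
  ; label-leaf = λ x → leaf⁻ (subst (IsLeaf tree) (≡-sym (label⁻-spec x)) (label-leaf x))
  ; width      = λ t int S closed → width (punchIn ℓ t) (λ leaf′ → int (leaf⁻ leaf′)) S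
                   λ x y (_ , w) →
                     closed x y (shortcutᵃ w (≡-sym (label⁻-spec x)) (≡-sym (label⁻-spec y)))
  ; radius     = radius⁻ (proj₁ tree-ok) (label⁻ x₀) radius
  }
  where
  open Draft D
  open LeafDeletion tree ℓ leaf
  label⁻ : Fin n → Fin m
  label⁻ x = punchOut (unlabelled x)
  label⁻-spec : ∀ x → punchIn ℓ (label⁻ x) ≡ label x
  label⁻-spec x = punchIn-punchOut (unlabelled x)

isLeaf? : ∀ {m} (T : Graph m) ℓ → Dec (IsLeaf T ℓ)
isLeaf? T ℓ = all? λ x → all? λ y →
  (adj T ℓ x ≟ᵇ true) →-dec ((adj T ℓ y ≟ᵇ true) →-dec (x ≟ y))

-- Pruning: deleting unlabelled leaves one at a time turns a draft into a
-- decomposition.  Two labels whose leaves are nonadjacent guarantee that an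
-- internal node survives.
prune : ∀ {n m d k} {G : Graph n} (D : Draft G d k m) → let open Draft D in
  ∀ a b → a ≢ b → adj tree (label a) (label b) ≡ false → HasDecomp G d k
prune {m = zero} D a _ _ _ with Draft.label D a
... | ()
prune {m = suc m} D a b a≢b nadj
  with any? (λ ℓ → isLeaf? (Draft.tree D) ℓ ×-dec ¬? (any? λ x → Draft.label D x ≟ ℓ))
... | yes (ℓ , leaf , unlabelled) =
  prune (deleteLeaf D ℓ leaf (λ x ℓ≡ → unlabelled (x , ≡-sym ℓ≡)) a) a b a≢b
    (trans (cong₂ (adj (Draft.tree D)) (punchIn-punchOut _) (punchIn-punchOut _)) nadj)
... | no allLabelled = decomposition , width , radius
  where
  open Draft D
  decomposition : Decomposition _
  decomposition = record
    { m = suc m ; T = tree ; isTree = tree-ok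
    ; internal = internalOnWalk (proj₂ (proj₁ tree-ok (label a) (label b)))
                                (a≢b ∘ label-inj a b) nadj
    ; σ = label ; σ-inj = label-inj ; σ-leaf = label-leaf
    ; σ-onto = λ t leaf → decidable-stable (any? λ x → label x ≟ t)
                            λ unlabelled → allLabelled (t , leaf , unlabelled) }

module _ {m n} (T : Graph m) (σ : Fin n → Fin m) where

  together-sym : ∀ {t x y} → Together T σ t x y → Together T σ t y x
  together-sym (L , w) = L , reverseᵃ w

  together-trans : ∀ {t x y z} → Together T σ t x y → Together T σ t y z → Together T σ t x z
  together-trans (L , w) (L′ , w′) = L + L′ , w ++ᵃ w′

insertAt-closed : ∀ {m n} (T : Graph m) (σ : Fin (suc n) → Fin m) (v : Fin (suc n)) t
  (S : Fin n → Bool) (c : Bool) →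
  (∀ x y → Together T (σ ∘ punchIn v) t x y → S x ≡ S y) →
  (∀ y → Together T σ t v (punchIn v y) → c ≡ S y) →
  ∀ x y → Together T σ t x y → insertAt S v c x ≡ insertAt S v c y
insertAt-closed T σ v t S c closed agrees x y tog with deletionView v x | deletionView v y
... | deleted | deleted = refl
... | deleted | kept j  =
  trans (insertAt-lookup S v c) (trans (agrees j tog) (≡-sym (insertAt-punchIn S v c j)))
... | kept i  | deleted =
  trans (insertAt-punchIn S v c i)
        (trans (≡-sym (agrees i (together-sym T σ tog))) (≡-sym (insertAt-lookup S v c)))
... | kept i  | kept j  =
  trans (insertAt-punchIn S v c i) (trans (closed i j tog) (≡-sym (insertAt-punchIn S v c j)))

agreeingSide : ∀ {m n} (T : Graph m) (σ : Fin (suc n) → Fin m) (v : Fin (suc n)) t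
  (S : Fin n → Bool) → (∀ x y → Together T (σ ∘ punchIn v) t x y → S x ≡ S y) →
  ¬ ¬ ∃ λ c → ∀ y → Together T σ t v (punchIn v y) → c ≡ S y
agreeingSide T σ v t S closed none = ¬¬-excluded-middle λ dec → none (choose dec)
  where
  choose : Dec (∃ λ u → Together T σ t v (punchIn v u)) →
           ∃ λ c → ∀ y → Together T σ t v (punchIn v y) → c ≡ S y
  choose (yes (u , vu)) = S u , λ y vy → closed u y (together-trans T σ (together-sym T σ vu) vy)
  choose (no  alone)    = false , λ y vy → ⊥-elim (alone (y , vy))

-- Forgetting the label of v: the width bound of a labelled tree for G holds
-- for G − v, since every union of parts of G − v extends to one of G.
restrict-width : ∀ {m n k} (G : Graph (suc n)) (T : Graph m) (σ : Fin (suc n) → Fin m)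
  (v : Fin (suc n)) → LabelledWidthLe G T σ k → LabelledWidthLe (G ─ v) T (σ ∘ punchIn v) k
restrict-width G T σ v width t int S closed = cutRank-stable {G = G ─ v} λ ¬bound →
  agreeingSide T σ v t S closed λ (c , agrees) →
    ¬bound (cutRank-restrict G v (insertAt S v c) S (insertAt-punchIn S v c)
             (width t int (insertAt S v c) (insertAt-closed T σ v t S c closed agrees)))

decomposition-delete : ∀ {n d k} (G : Graph (suc n)) (v : Fin (suc n)) (a b : Fin n) → a ≢ b →
  HasDecomp G d k → HasDecomp (G ─ v) d k
decomposition-delete G v a b a≢b (D , W , R) = prune draft a b a≢b nonadjacent
  where
  draft : Draft (G ─ v) _ _ (m D)
  draft = record
    { tree = T D ; tree-ok = isTree D ; label = σ D ∘ punchIn v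
    ; label-inj = λ x y eq → punchIn-injective v x y (σ-inj D _ _ eq)
    ; label-leaf = σ-leaf D ∘ punchIn v
    ; width = restrict-width G (T D) (σ D) v W ; radius = R }
  nonadjacent : adj (T D) (σ D (punchIn v a)) (σ D (punchIn v b)) ≡ false
  nonadjacent = ¬-not (leaves-nonadjacent (proj₁ (isTree D)) (internal D)
                         (σ-leaf D (punchIn v a)) (σ-leaf D (punchIn v b)))

closed-modify : ∀ {m n} (T : Graph m) (σ : Fin n → Fin m) t (S S′ : Fin n → Bool) u →
  (∀ y → Together T σ t u y → u ≡ y) → (∀ x → x ≢ u → S′ x ≡ S x) →
  (∀ x y → Together T σ t x y → S x ≡ S y) → ∀ x y → Together T σ t x y → S′ x ≡ S′ y
closed-modify T σ t S S′ u alone same closed x y xy with x ≟ u | y ≟ u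
... | yes refl | _        = cong S′ (alone y xy)
... | no  _    | yes refl = cong S′ (≡-sym (alone x (together-sym T σ xy)))
... | no  x≢u  | no  y≢u  = trans (same x x≢u) (trans (closed x y xy) (≡-sym (same y y≢u)))

-- rb_d(G) ≤ rb_d(G − v) for a vertex v with twins w, z (d ≥ 2): attach a new
-- leaf for v to the neighbour p of the leaf q of w.
module AddTwin {n d k} (G : Graph (suc n)) {v w : Fin (suc n)} (v≢w : v ≢ w)
               (D : Decomposition (G ─ v)) (W : WidthLe D k) (R : RadiusLe (T D) d) where

  private
    w′ : Fin n
    w′ = punchOut v≢w

    q : Fin (m D)
    q = σ D w′

    q-leaf : IsLeaf (T D) q
    q-leaf = σ-leaf D w′

    -- the leaf q has a neighbour, as the tree has an internal node
    parent : ∃ λ p → adj (T D) q p ≡ true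
    parent = first (proj₂ (proj₁ (isTree D) q (proj₁ (internal D)))) (proj₂ (internal D))
      where
      first : ∀ {t L} → Walk (T D) q t L → Internal (T D) t → ∃ λ p → adj (T D) q p ≡ true
      first (here _)   int = ⊥-elim (int q-leaf)
      first (step e _) _   = _ , e

  p : Fin (m D)
  p = proj₁ parent

  private
    q-p : adj (T D) q p ≡ true
    q-p = proj₂ parent

    p-internal : Internal (T D) p
    p-internal p-leaf = leaves-nonadjacent (proj₁ (isTree D)) (internal D) q-leaf p-leaf q-p

    label-not-p : ∀ x → σ D x ≢ p
    label-not-p x eq = p-internal (subst (IsLeaf (T D)) eq (σ-leaf D x))

  open Attach (T D) p

  σ⁺ : Fin (suc n) → Fin (suc (m D))
  σ⁺ = insertAt (suc ∘ σ D) v zero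

  σ⁺-v : σ⁺ v ≡ zero
  σ⁺-v = insertAt-lookup (suc ∘ σ D) v zero

  σ⁺-old : ∀ i → σ⁺ (punchIn v i) ≡ suc (σ D i)
  σ⁺-old = insertAt-punchIn (suc ∘ σ D) v zero

  D⁺ : Decomposition G
  D⁺ = record
    { m = suc (m D) ; T = T⁺ ; isTree = isTree⁺ (isTree D)
    ; internal = suc p , λ leaf → p-internal (leaf-before leaf)
    ; σ = σ⁺ ; σ-inj = σ⁺-inj ; σ-leaf = σ⁺-leaf ; σ-onto = σ⁺-onto }
    where
    σ⁺-inj : ∀ x y → σ⁺ x ≡ σ⁺ y → x ≡ y
    σ⁺-inj x y eq with deletionView v x | deletionView v y
    ... | deleted | deleted = refl
    ... | deleted | kept j  with () ← trans (≡-sym σ⁺-v) (trans eq (σ⁺-old j))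
    σ⁺-inj x y eq | kept i | deleted with () ← trans (≡-sym (σ⁺-old i)) (trans eq σ⁺-v)
    σ⁺-inj x y eq | kept i | kept j =
      cong (punchIn v)
           (σ-inj D i j (suc-injective (trans (≡-sym (σ⁺-old i)) (trans eq (σ⁺-old j)))))
    σ⁺-leaf : ∀ x → IsLeaf T⁺ (σ⁺ x)
    σ⁺-leaf x with deletionView v x
    ... | deleted = subst (IsLeaf T⁺) (≡-sym σ⁺-v) new-leaf
    ... | kept i  = subst (IsLeaf T⁺) (≡-sym (σ⁺-old i)) (old-leaf (σ-leaf D i) (label-not-p i))
    σ⁺-onto : ∀ t → IsLeaf T⁺ t → ∃ λ x → σ⁺ x ≡ t
    σ⁺-onto zero     _    = v , σ⁺-v
    σ⁺-onto (suc t′) leaf = let (i , σi≡t′) = σ-onto D t′ (leaf-before leaf)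
                            in punchIn v i , trans (σ⁺-old i) (cong suc σi≡t′)

  -- The new leaf is within distance d of the old centre: reach q's parent p
  -- instead of q in the last step (or go q – p – new leaf, using d ≥ 2).
  radius⁺ : 2 ≤ d → RadiusLe T⁺ d
  radius⁺ 2≤d = suc (proj₁ R) , ecc⁺
    where
    toNewLeaf : ∀ {c b L} → Walk (T D) c b L → L ≤ d → IsLeaf (T D) b → adj (T D) b p ≡ true →
                ∃ λ L′ → L′ ≤ d × Walk T⁺ (suc c) zero L′
    toNewLeaf (here _) _ _ b-p = 2 , 2≤d , step {b = suc p} b-p (step new-edge′ (here zero))
    toNewLeaf {L = suc L} w L≤d b-leaf b-p with unsnocʷ w
    ... | _ , w′ , e with b-leaf _ _ (trans (sym (T D) _ _) e) b-p
    ...   | refl = suc L , L≤d , snocʷ (lift w′) new-edge′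
    ecc⁺ : ∀ t → ∃ λ L → L ≤ d × Walk T⁺ (suc (proj₁ R)) t L
    ecc⁺ zero    = let (L , L≤d , w) = proj₂ R q in toNewLeaf w L≤d q-leaf q-p
    ecc⁺ (suc t) = let (L , L≤d , w) = proj₂ R t in L , L≤d , lift w

  restrict-closed : ∀ t (S : Fin (suc n) → Bool) → (∀ x y → SameComp D⁺ (suc t) x y → S x ≡ S y) →
                    ∀ x y → SameComp D t x y → S (punchIn v x) ≡ S (punchIn v y)
  restrict-closed t S closed x y (L , wk) = closed _ _
    (L , subst₂ (λ a b → WalkAvoid T⁺ (suc t) a b L) (≡-sym (σ⁺-old x)) (≡-sym (σ⁺-old y))
                (liftᵃ wk))

  v-with-w : ∀ t → Internal (T D) t → t ≢ p → SameComp D⁺ (suc t) v w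
  v-with-w t t-int t≢p = 2 , subst₂ (λ a b → WalkAvoid T⁺ (suc t) a b 2) (≡-sym σ⁺-v) σ⁺w walk
    where
    σ⁺w : suc q ≡ σ⁺ w
    σ⁺w = trans (≡-sym (σ⁺-old w′)) (cong σ⁺ (punchIn-punchOut v≢w))
    walk : WalkAvoid T⁺ (suc t) zero (suc q) 2
    walk = step (λ ()) new-edge
             (step (λ p≡t → t≢p (≡-sym (suc-injective p≡t))) (trans (sym (T D) p q) q-p)
               (here (suc q) λ q≡t → t-int (subst (IsLeaf (T D)) (suc-injective q≡t) q-leaf)))

  w-alone : ∀ y → SameComp D p w′ y → w′ ≡ y
  w-alone y (_ , wk) = σ-inj D w′ y (pendantAlone wk q-leaf q-p)

  -- At t ≠ p, S(v) = S(w) and v can be deleted.  At p, if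
  -- S(v) differs from both S(w) and S(z), then S(w) = S(z); swapping the twins
  -- v and w makes v agree with z, and w's singleton part absorbs the change.
  width⁺ : ∀ {z} → v ≢ z → w ≢ z → Twins G v w → Twins G v z → WidthLe D⁺ k
  width⁺ v≢z w≢z tvw tvz zero    int = ⊥-elim (int new-leaf)
  width⁺ {z} v≢z w≢z tvw tvz (suc t) int S closed with t ≟ p
  ... | no t≢p = cutRank-twinDelete G v≢w tvw S (closed v w (v-with-w t t-int t≢p))
                   (W t t-int (S ∘ punchIn v) (restrict-closed t S closed))
    where
    t-int : Internal (T D) t
    t-int leaf = int (old-leaf leaf t≢p)
  ... | yes refl with S v ≟ᵇ S w | S v ≟ᵇ S z
  ...   | yes Sv≡Sw | _         = cutRank-twinDelete G v≢w tvw S Sv≡Sw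
                                    (W p p-internal (S ∘ punchIn v) (restrict-closed p S closed))
  ...   | no  _     | yes Sv≡Sz = cutRank-twinDelete G v≢z tvz S Sv≡Sz
                                    (W p p-internal (S ∘ punchIn v) (restrict-closed p S closed))
  ...   | no  Sv≢Sw | no  Sv≢Sz = cutRank-twinSwap G tvw S
    (cutRank-twinDelete G v≢z tvz (S ∘ τ) Sτv≡Sτz
      (W p p-internal (S ∘ τ ∘ punchIn v)
         (closed-modify (T D) (σ D) p (S ∘ punchIn v) (S ∘ τ ∘ punchIn v) w′ w-alone
            τ-fixes-others (restrict-closed p S closed))))
    where
    τ : Fin (suc n) → Fin (suc n)
    τ = transpose v w
    Sτv≡Sτz : S (τ v) ≡ S (τ z)
    Sτv≡Sτz = begin
      S (τ v) ≡⟨ cong S (transpose-first v w) ⟩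
      S w     ≡⟨ other-side Sv≢Sw Sv≢Sz ⟩
      S z     ≡⟨ cong S (transpose-fixes (v≢z ∘ ≡-sym) (w≢z ∘ ≡-sym)) ⟨
      S (τ z) ∎
      where open ≡-Reasoning
    τ-fixes-others : ∀ x → x ≢ w′ → S (τ (punchIn v x)) ≡ S (punchIn v x)
    τ-fixes-others x x≢w′ = cong S (transpose-fixes (punchInᵢ≢i v x)
      λ x≡w → x≢w′ (punchIn-injective v x w′ (trans x≡w (≡-sym (punchIn-punchOut v≢w)))))

two≤ : ∀ {n} (a b : Fin n) → a ≢ b → 2 ≤ n
two≤ {suc zero}    zero zero a≢b = ⊥-elim (a≢b refl)
two≤ {suc (suc n)} _    _    _   = s≤s (s≤s z≤n)

rb-transfer : ∀ {n₁ n₂ d k} {G : Graph n₁} {H : Graph n₂} → 2 ≤ n₁ → 2 ≤ n₂ →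
  (∀ {k} → HasDecomp G d k → HasDecomp H d k) → (∀ {k} → HasDecomp H d k → HasDecomp G d k) →
  Rb d G k → Rb d H k
rb-transfer 2≤n₁ _    _  _    (inj₁ (n₁<2 , _))      = ⊥-elim (<⇒≱ n₁<2 2≤n₁)
rb-transfer _    2≤n₂ to from (inj₂ (_ , dec , least)) =
  inj₂ (2≤n₂ , to dec , λ k′ dec′ → least k′ (from dec′))

-- The theorem: both directions are transfers of attainable widths.
lemma3p1 : (d : ℕ) → 2 ≤ d → {n : ℕ} → (G : Graph (suc n)) →
           (v w z : Fin (suc n)) → v ≢ w → v ≢ z → w ≢ z →
           Twins G v w → Twins G v z → Twins G w z →
           (k : ℕ) → (Rb d G k → Rb d (G ─ v) k) × (Rb d (G ─ v) k → Rb d G k)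
lemma3p1 d 2≤d {n} G v w z v≢w v≢z w≢z tvw tvz _ k =
  rb-transfer 2≤1+n 2≤n delete add , rb-transfer 2≤n 2≤1+n add delete
  where
  w≢z′ : punchOut v≢w ≢ punchOut v≢z
  w≢z′ = w≢z ∘ punchOut-injective v≢w v≢z
  2≤n : 2 ≤ n
  2≤n = two≤ _ _ w≢z′
  2≤1+n : 2 ≤ suc n
  2≤1+n = ≤-trans 2≤n (n≤1+n n)
  add : ∀ {k} → HasDecomp (G ─ v) d k → HasDecomp G d k
  add (D , W , R) = D⁺ , width⁺ v≢z w≢z tvw tvz , radius⁺ 2≤d
    where open AddTwin G v≢w D W R
  delete : ∀ {k} → HasDecomp G d k → HasDecomp (G ─ v) d k
  delete = decomposition-delete G v _ _ w≢z′
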